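{- Let $G$ be a finite, simple, undirected, connected graph, let $S$ be a maximal independent set of $G$, and let $f:V(G)\to S$ be defined by $f(v)=v$ if $v\in S$, and otherwise $f(v)$ is any vertex $w\in S$ adjacent to $v$ in $G$. Then $f$, viewed as a map from $G$ (with its shortest-path metric) to the MIS-derived graph on $S$ (with its shortest-path metric), is a $(3,1,0)$-quasi-isometry.
   Context: The MIS-derived graph has vertex set $S$, with distinct $x,y\in S$ adjacent iff $d_G(x,y)\le3$; it is connected. For metric spaces $(M_1,d_1),(M_2,d_2)$ and non-negative integers $A,B,C$ with $A\ge1$, a map $f:M_1\to M_2$ is an $(A,B,C)$-quasi-isometry if (Q1) for all $x,y$: $\frac1A d_1(x,y)-B\le d_2(f(x),f(y))\le A\,d_1(x,y)+B$, and (Q2) for every $y\in M_2$ there is $x\in M_1$ with $d_2(y,f(x))\le C$. -}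

module Defs where

open import Data.Nat using (ℕ; zero; suc; _+_; _*_; _≤_)
open import Data.Fin using (Fin)
open import Data.Fin.Subset using (Subset; _∈_; _∉_; _⊆_)
open import Data.Product using (Σ; ∃; _×_; _,_; proj₁)
open import Relation.Nullary using (¬_; Dec)
open import Relation.Binary.PropositionalEquality using (_≡_; _≢_)

record SimpleGraph (n : ℕ) : Set₁ where
  field
    Adj    : Fin n → Fin n → Set
    sym    : ∀ {x y} → Adj x y → Adj y x
    irrefl : ∀ {x} → ¬ Adj x x
    dec    : ∀ x y → Dec (Adj x y)

data Walk {V : Set} (E : V → V → Set) : V → V → ℕ → Set where
  []  : ∀ {x} → Walk E x x 0
  _∷_ : ∀ {x y z k} → E x y → Walk E y z k → Walk E x z (suc k)

record IsDist {V : Set} (E : V → V → Set) (x y : V) (k : ℕ) : Set where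
  field
    walk    : Walk E x y k
    minimal : ∀ {m} → Walk E x y m → k ≤ m

Connected : {V : Set} → (V → V → Set) → Set
Connected {V} E = ∀ (x y : V) → ∃ λ k → Walk E x y k

module _ {n : ℕ} (G : SimpleGraph n) where
  open SimpleGraph G

  IsIndependent : Subset n → Set
  IsIndependent S = ∀ x y → x ∈ S → y ∈ S → ¬ Adj x y

  IsMaximalIndependent : Subset n → Set
  IsMaximalIndependent S =
    IsIndependent S × (∀ T → IsIndependent T → S ⊆ T → T ⊆ S)

  VS : Subset n → Set
  VS S = Σ (Fin n) (λ v → v ∈ S)

  DerivedAdj : (S : Subset n) → VS S → VS S → Set
  DerivedAdj S (x , _) (y , _) =
    x ≢ y × ∃ λ k → k ≤ 3 × IsDist Adj x y k

-- (A,B,C)-quasi-isometry between metric spaces whose (ℕ-valued) metrics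
-- are given as relations d x y k meaning "d(x,y) = k".
-- (Q1) lower bound (1/A) a - B ≤ b is written, multiplying by A ≥ 1,
-- as a ≤ A * (b + B).
record IsQuasiIsometry {M₁ M₂ : Set}
    (d₁ : M₁ → M₁ → ℕ → Set) (d₂ : M₂ → M₂ → ℕ → Set)
    (A B C : ℕ) (f : M₁ → M₂) : Set where
  field
    A≥1   : 1 ≤ A
    Q1-lo : ∀ x y a b → d₁ x y a → d₂ (f x) (f y) b → a ≤ A * (b + B)
    Q1-hi : ∀ x y a b → d₁ x y a → d₂ (f x) (f y) b → b ≤ A * a + B
    Q2    : ∀ y → ∃ λ x → ∃ λ c → d₂ y (f x) c × c ≤ C

module Submission where

open import Defs
open import Data.Nat using (ℕ; zero; suc; _+_; _*_; _≤_; _≤?_; z≤n; s≤s)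
open import Data.Nat.Properties
  using (≤-refl; ≤-trans; ≰⇒>; n≤0⇒n≡0; m≤n⇒m≤1+n; m≤n⇒m<n∨m≡n; +-mono-≤; *-suc; m≤n*m; m≤m+n; module ≤-Reasoning)
open import Data.Nat.Tactic.RingSolver using (solve-∀)
open import Data.Fin using (Fin; _≟_)
open import Data.Fin.Properties using (any?)
open import Data.Fin.Subset using (Subset; _∈_; _∉_)
open import Data.Fin.Subset.Properties using (_∈?_)
open import Data.Vec.Properties.WithK using ([]=-irrelevant)
open import Data.Product using (∃; _×_; _,_; proj₁)
open import Data.Sum as Sum using (_⊎_; inj₁; inj₂)
open import Data.Empty using (⊥-elim)
open import Relation.Nullary using (Dec; yes; no; ¬_)
open import Relation.Nullary.Decidable using (map′; _×-dec_)
open import Relation.Binary.PropositionalEquality using (_≡_; refl; sym; cong; subst)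

-- f moves each vertex by at most one step and is the identity on S.  Hence
-- a G-edge x z is sent either to a single point or to two vertices joined by
-- the G-walk f x, x, z, f z of length ≤ 3, i.e. to a derived edge; and a
-- derived edge is a G-walk of length ≤ 3.  Comparing walks in both graphs
-- gives the two inequalities of (Q1), and (Q2) holds with C = 0 since f
-- fixes S.

∄≤⊎least : {P : ℕ → Set} → (∀ k → Dec (P k)) →
        ∀ k → (∀ {m} → m ≤ k → ¬ P m) ⊎ ∃ λ j → j ≤ k × P j × (∀ {m} → P m → j ≤ m)
∄≤⊎least {P} P? zero with P? zero
... | yes p = inj₂ (0 , z≤n , p , λ _ → z≤n)
... | no ¬p = inj₁ λ m≤0 → subst (λ m → ¬ P m) (sym (n≤0⇒n≡0 m≤0)) ¬p
∄≤⊎least {P} P? (suc k) with ∄≤⊎least P? k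
... | inj₂ (j , j≤k , pj , minimal) = inj₂ (j , m≤n⇒m≤1+n j≤k , pj , minimal)
... | inj₁ none with P? (suc k)
...   | yes p = inj₂ (suc k , ≤-refl , p , above)
  where
  above : ∀ {m} → P m → suc k ≤ m
  above {m} pm with m ≤? k
  ... | yes m≤k = ⊥-elim (none m≤k pm)
  ... | no m≰k = ≰⇒> m≰k
...   | no ¬p = inj₁ below
  where
  below : ∀ {m} → m ≤ suc k → ¬ P m
  below m≤1+k with m≤n⇒m<n∨m≡n m≤1+k
  ... | inj₁ (s≤s m≤k) = none m≤k
  ... | inj₂ refl = ¬p

suc[3b+1]+1≡3[b+1] : ∀ b → 1 + (3 * b + 1) + 1 ≡ 3 * (b + 1)
suc[3b+1]+1≡3[b+1] = solve-∀

_++ᵂ_ : ∀ {V : Set} {E : V → V → Set} {x y z k m} →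
        Walk E x y k → Walk E y z m → Walk E x z (k + m)
[] ++ᵂ w = w
(e ∷ v) ++ᵂ w = e ∷ (v ++ᵂ w)

IsDist-refl : ∀ {V : Set} {E : V → V → Set} {x} → IsDist E x x 0
IsDist-refl = record { walk = [] ; minimal = λ _ → z≤n }

reflexive⇒Walk≤1 : ∀ {V : Set} {E : V → V → Set} {x y} →
                   x ≡ y ⊎ E x y → ∃ λ k → k ≤ 1 × Walk E x y k
reflexive⇒Walk≤1 (inj₁ refl) = 0 , z≤n , []
reflexive⇒Walk≤1 (inj₂ e)    = 1 , ≤-refl , e ∷ []

module _ {V W : Set} {E : V → V → Set} {F : W → W → Set} where

  Walk-contract : (g : V → W) → (∀ {x y} → E x y → g x ≡ g y ⊎ F (g x) (g y)) →
                  ∀ {x y a} → Walk E x y a → ∃ λ m → m ≤ a × Walk F (g x) (g y) m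
  Walk-contract g edge [] = 0 , z≤n , []
  Walk-contract g edge {y = y} (e ∷ w) with Walk-contract g edge w | edge e
  ... | m , m≤a , w′ | inj₁ gx≡gz =
    m , m≤n⇒m≤1+n m≤a , subst (λ t → Walk F t (g y) m) (sym gx≡gz) w′
  ... | m , m≤a , w′ | inj₂ e′ = suc m , s≤s m≤a , e′ ∷ w′

  Walk-stretch : (h : W → V) (c : ℕ) → (∀ {x y} → F x y → ∃ λ k → k ≤ c × Walk E (h x) (h y) k) →
                 ∀ {x y b} → Walk F x y b → ∃ λ k → k ≤ c * b × Walk E (h x) (h y) k
  Walk-stretch h c edge [] = 0 , z≤n , []
  Walk-stretch h c edge {b = suc b} (e ∷ w) with edge e | Walk-stretch h c edge w
  ... | j , j≤c , v | k , k≤cb , v′ =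
    j + k , subst (j + k ≤_) (sym (*-suc c b)) (+-mono-≤ j≤c k≤cb) , v ++ᵂ v′

module _ {n : ℕ} {E : Fin n → Fin n → Set} (E? : ∀ x y → Dec (E x y)) where

  Walk? : ∀ k x y → Dec (Walk E x y k)
  Walk? zero x y = map′ (λ { refl → [] }) (λ { [] → refl }) (x ≟ y)
  Walk? (suc k) x y =
    map′ (λ (_ , e , w) → e ∷ w) (λ { (e ∷ w) → _ , e , w })
         (any? λ z → E? x z ×-dec Walk? k z y)

  Walk⇒IsDist : ∀ {x y k} → Walk E x y k → ∃ λ j → j ≤ k × IsDist E x y j
  Walk⇒IsDist {x} {y} {k} w with ∄≤⊎least (λ m → Walk? m x y) k
  ... | inj₁ none = ⊥-elim (none ≤-refl w)
  ... | inj₂ (j , j≤k , v , minimal) = j , j≤k , record { walk = v ; minimal = minimal }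

module DerivedGraph {n : ℕ} (G : SimpleGraph n) (S : Subset n) where
  open SimpleGraph G using (Adj; dec) renaming (sym to Adj-sym)

  VS-≡ : {a b : VS G S} → proj₁ a ≡ proj₁ b → a ≡ b
  VS-≡ {a , p} {.a , q} refl = cong (a ,_) ([]=-irrelevant p q)

  DerivedAdj⇒Walk≤3 : ∀ {p q} → DerivedAdj G S p q → ∃ λ k → k ≤ 3 × Walk Adj (proj₁ p) (proj₁ q) k
  DerivedAdj⇒Walk≤3 (_ , j , j≤3 , d) = j , j≤3 , IsDist.walk d

  module _ (f : Fin n → VS G S) (near : ∀ v → v ≡ proj₁ (f v) ⊎ Adj v (proj₁ (f v))) where

    Adj⇒≡⊎DerivedAdj : ∀ {x z} → Adj x z → f x ≡ f z ⊎ DerivedAdj G S (f x) (f z)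
    Adj⇒≡⊎DerivedAdj {x} {z} e with proj₁ (f x) ≟ proj₁ (f z)
    ... | yes fx≡fz = inj₁ (VS-≡ fx≡fz)
    ... | no fx≢fz with reflexive⇒Walk≤1 (Sum.map sym Adj-sym (near x)) | reflexive⇒Walk≤1 (near z)
    ...   | k , k≤1 , back | l , l≤1 , forth with Walk⇒IsDist dec (back ++ᵂ (e ∷ forth))
    ...     | j , j≤ , d = inj₂ (fx≢fz , j , ≤-trans j≤ (+-mono-≤ k≤1 (s≤s l≤1)) , d)

    dist-f≤3*dist+1 : ∀ x y a b → IsDist Adj x y a → IsDist (DerivedAdj G S) (f x) (f y) b → b ≤ 3 * a + 1
    dist-f≤3*dist+1 x y a b dxy dfxfy with Walk-contract f Adj⇒≡⊎DerivedAdj (IsDist.walk dxy)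
    ... | m , m≤a , w = begin
      b         ≤⟨ IsDist.minimal dfxfy w ⟩
      m         ≤⟨ m≤a ⟩
      a         ≤⟨ m≤n*m a 3 ⟩
      3 * a     ≤⟨ m≤m+n (3 * a) 1 ⟩
      3 * a + 1 ∎
      where open ≤-Reasoning

    dist≤3*[dist-f+1] : ∀ x y a b → IsDist Adj x y a → IsDist (DerivedAdj G S) (f x) (f y) b → a ≤ 3 * (b + 1)
    dist≤3*[dist-f+1] x y a b dxy dfxfy
      -- eta-expanded: DerivedAdj reduces only on pairs, so its endpoints cannot be inferred
      with reflexive⇒Walk≤1 (near x)
         | Walk-stretch proj₁ 3 (λ {p} {q} → DerivedAdj⇒Walk≤3 {p} {q}) (IsDist.walk dfxfy)
         | reflexive⇒Walk≤1 (Sum.map sym Adj-sym (near y))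
    ... | k , k≤1 , forth | m , m≤3b , w | l , l≤1 , back = begin
      a                 ≤⟨ IsDist.minimal dxy (forth ++ᵂ (w ++ᵂ back)) ⟩
      k + (m + l)       ≤⟨ +-mono-≤ k≤1 (+-mono-≤ m≤3b l≤1) ⟩
      1 + (3 * b + 1)   ≤⟨ m≤m+n (1 + (3 * b + 1)) 1 ⟩
      1 + (3 * b + 1) + 1 ≡⟨ suc[3b+1]+1≡3[b+1] b ⟩
      3 * (b + 1)       ∎
      where open ≤-Reasoning

corollary1 : ∀ {n : ℕ} (G : SimpleGraph n) → Connected (SimpleGraph.Adj G) →
    (S : Subset n) → IsMaximalIndependent G S →
    (f : Fin n → VS G S) →
    (∀ v → v ∈ S → proj₁ (f v) ≡ v) →
    (∀ v → v ∉ S → SimpleGraph.Adj G v (proj₁ (f v))) →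
    IsQuasiIsometry (IsDist (SimpleGraph.Adj G)) (IsDist (DerivedAdj G S)) 3 1 0 f
corollary1 G _ S _ f fixes moves = record
  { A≥1   = s≤s z≤n
  ; Q1-lo = dist≤3*[dist-f+1] f near
  ; Q1-hi = dist-f≤3*dist+1 f near
  ; Q2    = λ (v , v∈S) → v , 0 , subst (λ t → IsDist (DerivedAdj G S) (v , v∈S) t 0)
                                        (VS-≡ (sym (fixes v v∈S))) IsDist-refl , z≤n
  }
  where
  open DerivedGraph G S
  near : ∀ v → v ≡ proj₁ (f v) ⊎ SimpleGraph.Adj G v (proj₁ (f v))
  near v with v ∈? S
  ... | yes v∈S = inj₁ (sym (fixes v v∈S))
  ... | no  v∉S = inj₂ (moves v v∉S)
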